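{- Let $\alpha>0$ be a countable ordinal, $\mathsf{C}$ a context-machine, and $M,N\in\mathcal{M}$ with $M\approx_\alpha N$. If $\mathsf{C}\to_h^M\mathsf{C}'$ (with $\mathsf{C}'$ having finitely many occurrences of $\xi$) and $\mathsf{C}'\langle M\rangle$ does not head-reduce to a stuck machine, then there exists $\gamma<\alpha$ such that $\mathsf{C}\langle N\rangle\equiv_\gamma\mathsf{C}'\langle N\rangle$.
   Context: Addressing machines. Fix a countable set $\mathbb{A}$ of addresses and a symbol $\varnothing\notin\mathbb{A}$; $\mathbb{A}_\varnothing=\mathbb{A}\cup\{\varnothing\}$. A tape is a finite list of addresses; $a::T$ has head $a$ and tail $T$, $T@T'$ is concatenation. A program is a finite list of instructions generated by $P::=\mathtt{Load}\ i;P\mid A$, $A::=\mathtt{App}(i,j,k);A\mid C$, $C::=\mathtt{Call}\ i\mid\varepsilon$ ($i,j,k\in\mathbb{N}$). For $r\in\mathbb{N}$, $I\subseteq\{0,\dots,r-1\}$, $I\models^r P$ is the least relation such that: $I\models^r\varepsilon$; $I\models^r\mathtt{Call}\ i$ if $i\in I$; $I\models^r\mathtt{App}(i,j,k);A$ if $i,j\in I$ and either ($k<r$ and $I\cup\{k\}\models^r A$) or ($k\ge r$ and $I\models^r A$); $I\models^r\mathtt{Load}\ i;P$ if either ($i<r$ and $I\cup\{i\}\models^r P$) or ($i\ge r$ and $I\models^r P$). An addressing machine is $M=\langle R_0,\dots,R_{r-1},P,T\rangle$ with registers in $\mathbb{A}_\varnothing$, $P$ valid w.r.t. the registers ($\{i<r\mid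 R_i\ne\varnothing\}\models^r P$), and an $\mathbb{A}$-valued tape; $\mathcal{M}$ is the set of all of them. $\vec R[R_i:=a]$ replaces $R_i$ by $a$ if $i<r$, is $\vec R$ if $i\ge r$; $M[R_i:=a]$ is $M$ with its registers so updated. $M$ is stuck if $M.P=\mathtt{Load}\ i;P'$ and $M.T=[]$. Fix a bijection $\#:\mathcal{M}\to\mathbb{A}$; $M@T'=\langle M.\vec R,M.P,M.T@T'\rangle$; $a\cdot b=\#(\#^{ -1}(a)@[b])$. Head reduction on $\mathcal{M}$: $\langle\vec R,\mathtt{Load}\ i;P,a::T\rangle\to_h\langle\vec R[R_i:=a],P,T\rangle$, $\langle\vec R,\mathtt{App}(i,j,k);P,T\rangle\to_h\langle\vec R[R_k:=R_i\cdot R_j],P,T\rangle$, $\langle\vec R,\mathtt{Call}\ i,T\rangle\to_h\#^{ -1}(R_i)@T$; "$M\twoheadrightarrow_h\mathrm{stuck}$" means $M\twoheadrightarrow_h N$ for some stuck $N$. Induced relations: for $\equiv_R$ on $\mathcal{M}$, $a\simeq_R b$ iff $\#^{ -1}(a)\equiv_R\#^{ -1}(b)$; on $\mathbb{A}_\varnothing$, both $\varnothing$ or both related addresses; componentwise on tuples/tapes of equal length; $M=_R N$ iff $M.\vec R\simeq_R N.\vec R$, $M.P=N.P$, $M.T\simeq_R N.T$. $\equiv_{\mathbb{A}}$ is the least equivalence on $\mathcal{M}$ with $M\twoheadrightarrow_h Z=_{\mathbb{A}}N\Rightarrow M\equiv_{\mathbb{A}}N$. Ordinal-indexed relations: for each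 countable ordinal $\alpha$, $\equiv_\alpha,\sim_\alpha,\approx_\alpha$ on $\mathcal{M}$ are (simultaneously) the least reflexive and symmetric relations closed under: $M\equiv_{\mathbb{A}}N\Rightarrow M\approx_0N$; $M\approx_\alpha N\Rightarrow M\sim_\alpha N$; $M\sim_\alpha N\Rightarrow M\equiv_\alpha N$; if $M\twoheadrightarrow_h\mathrm{stuck}$, $N\twoheadrightarrow_h\mathrm{stuck}$ and for every $a\in\mathbb{A}$ there is $\gamma<\alpha$ with $M@[a]\equiv_\gamma N@[a]$, then $M\approx_\alpha N$; if $\#^{ -1}(a)\sim_\alpha\#^{ -1}(b)$ then $M[R_i:=a]\sim_\alpha M[R_i:=b]$ and $M@[a]\sim_\alpha M@[b]$; $M\sim_\alpha N\Rightarrow M@T\sim_\alpha N@T$ for every tape $T$; the same three rules with $\equiv_\alpha$ in place of $\sim_\alpha$; monotonicity in the ordinal ($\gamma\le\alpha$) for each of the three relations; and transitivity of $\equiv_\alpha$. Extended machines. Let $\xi=\langle[]\rangle$ be a new object (the hole). Fix a countable $\mathbb{B}$ with $\mathbb{A}\cap\mathbb{B}=\emptyset$, $\mathbb{X}=\mathbb{A}\cup\mathbb{B}$, $\mathbb{X}_\varnothing=\mathbb{X}\cup\{\varnothing\}$. An extended machine is either $\xi@T$ with $T$ an $\mathbb{X}$-valued tape, or $\langle\vec R,P,T\rangle$ with $\mathbb{X}_\varnothing$-valued registers, valid program, $\mathbb{X}$-valued tape. Fix a bijection $\underline{\#}$ from extended machines to $\mathbb{X}$ extending $\#$. $(\xi@T)@T'=\xi@(T@T')$.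 $\mathrm{occ}_\xi(X)\in\mathbb{N}\cup\{\infty\}$ counts with multiplicity the occurrences of $\xi$ reached by recursively dereferencing via $\underline{\#}^{ -1}$ all addresses in registers and tape ($\xi@T$ contributes $1$ plus those of $T$). A context-machine is an extended machine $\mathsf{C}$ with $\mathrm{occ}_\xi(\mathsf{C})$ finite; then $\mathsf{C}\langle M\rangle\in\mathcal{M}$ is obtained by recursively replacing every occurrence of $\xi$ by $M$: $(\xi@T)\langle M\rangle=M@(T\langle M\rangle)$, $\langle\vec R,P,T\rangle\langle M\rangle=\langle\vec R\langle M\rangle,P,T\langle M\rangle\rangle$, $a\langle M\rangle=\underline{\#}(\underline{\#}^{ -1}(a)\langle M\rangle)$, $\varnothing\langle M\rangle=\varnothing$. The $M$-underlined head reduction $\to_h^M$ on extended machines consists of the head-reduction rules (using $\underline{\#}$, $\underline{\#}^{ -1}$ for addresses) plus the rule $\xi@T\to_h^M M@T$. -}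

module Defs where

open import Level using (0ℓ)
open import Data.Nat using (ℕ; zero; suc; _+_)
open import Data.Bool using (Bool; true; false)
open import Data.Maybe using (Maybe; just; nothing)
open import Data.List using (List; []; _∷_; _++_)
open import Data.Vec using (Vec; []; _∷_)
open import Data.Sum using (_⊎_; inj₁; inj₂)
open import Data.Product using (Σ; _×_; _,_; ∃)
open import Relation.Binary.PropositionalEquality using (_≡_; refl; subst; sym; cong)
open import Relation.Binary.Construct.Closure.ReflexiveTransitive using (Star)
open import Function.Bundles using (_↔_; Inverse)

-- Registers indexed by natural numbers (out-of-range = no effect)

lookupℕ : ∀ {X : Set} {r} → Vec X r → ℕ → Maybe X
lookupℕ [] _ = nothing
lookupℕ (x ∷ xs) zero = just x
lookupℕ (x ∷ xs) (suc i) = lookupℕ xs i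

setℕ : ∀ {X : Set} {r} → Vec X r → ℕ → X → Vec X r
setℕ [] _ _ = []
setℕ (x ∷ xs) zero y = y ∷ xs
setℕ (x ∷ xs) (suc i) y = x ∷ setℕ xs i y

data CallPart : Set where
  call : ℕ → CallPart
  ε    : CallPart

data AppPart : Set where
  app : ℕ → ℕ → ℕ → AppPart → AppPart
  end : CallPart → AppPart

data Program : Set where
  load : ℕ → Program → Program
  apps : AppPart → Program

-- Validity  I ⊨^r P, with I ⊆ {0,…,r-1} represented as a Vec Bool r.
-- "I ∪ {k} if k < r, I if k ≥ r" is exactly  setℕ I k true.

_∈ᵇ_ : ∀ {r} → ℕ → Vec Bool r → Set
i ∈ᵇ I = lookupℕ I i ≡ just true

data _⊨C_ {r} (I : Vec Bool r) : CallPart → Set where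
  ε    : I ⊨C ε
  call : ∀ {i} → i ∈ᵇ I → I ⊨C call i

data _⊨A_ {r} : Vec Bool r → AppPart → Set where
  app : ∀ {I i j k A} → i ∈ᵇ I → j ∈ᵇ I → setℕ I k true ⊨A A → I ⊨A app i j k A
  end : ∀ {I C} → I ⊨C C → I ⊨A end C

data _⊨P_ {r} : Vec Bool r → Program → Set where
  load : ∀ {I i P} → setℕ I i true ⊨P P → I ⊨P load i P
  apps : ∀ {I A} → I ⊨A A → I ⊨P apps A

support : ∀ {X : Set} {r} → Vec (Maybe X) r → Vec Bool r
support [] = []
support (nothing ∷ R) = false ∷ support R
support (just _ ∷ R) = true ∷ support R

-- Machines over an address set X (∅ is nothing)

record Mach (X : Set) : Set where
  constructor mk
  field
    {r}   : ℕ
    regs  : Vec (Maybe X) r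
    prog  : Program
    tape  : List X
    valid : support regs ⊨P prog
open Mach public

_⊕T_ : ∀ {X} → Mach X → List X → Mach X
mk R P T v ⊕T T' = mk R P (T ++ T') v

_⊆ᵇ_ : ∀ {r} → Vec Bool r → Vec Bool r → Set
I ⊆ᵇ J = ∀ {i} → i ∈ᵇ I → i ∈ᵇ J

set-mono : ∀ {r} (I J : Vec Bool r) → I ⊆ᵇ J → ∀ k → setℕ I k true ⊆ᵇ setℕ J k true
set-mono [] [] s k {i} ()
set-mono (x ∷ I) (y ∷ J) s zero {zero} p = refl
set-mono (x ∷ I) (y ∷ J) s zero {suc i} p = s {suc i} p
set-mono (x ∷ I) (y ∷ J) s (suc k) {zero} p = s {zero} p
set-mono (x ∷ I) (y ∷ J) s (suc k) {suc i} p = set-mono I J (λ {j} q → s {suc j} q) k {i} p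

monoC : ∀ {r} (I J : Vec Bool r) {C} → I ⊆ᵇ J → I ⊨C C → J ⊨C C
monoC I J s ε = ε
monoC I J s (call p) = call (s p)

monoA : ∀ {r} (I J : Vec Bool r) {A} → I ⊆ᵇ J → I ⊨A A → J ⊨A A
monoA I J s (app {k = k} p q v) = app (s p) (s q) (monoA _ _ (set-mono I J s k) v)
monoA I J s (end c) = end (monoC I J s c)

monoP : ∀ {r} (I J : Vec Bool r) {P} → I ⊆ᵇ J → I ⊨P P → J ⊨P P
monoP I J s (load {i = i} v) = load (monoP _ _ (set-mono I J s i) v)
monoP I J s (apps v) = apps (monoA I J s v)

support-set : ∀ {X : Set} {r} (R : Vec (Maybe X) r) i x →
              support (setℕ R i (just x)) ≡ setℕ (support R) i true
support-set [] i x = refl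
support-set (nothing ∷ R) zero x = refl
support-set (just _ ∷ R) zero x = refl
support-set (nothing ∷ R) (suc i) x = cong (false ∷_) (support-set R i x)
support-set (just _ ∷ R) (suc i) x = cong (true ∷_) (support-set R i x)

support-⊆ : ∀ {X : Set} {r} (R : Vec (Maybe X) r) i x → support R ⊆ᵇ support (setℕ R i (just x))
support-⊆ [] i x ()
support-⊆ (nothing ∷ R) zero x {zero} ()
support-⊆ (just _ ∷ R) zero x {zero} p = refl
support-⊆ (nothing ∷ R) zero x {suc j} p = p
support-⊆ (just _ ∷ R) zero x {suc j} p = p
support-⊆ (nothing ∷ R) (suc i) x {zero} ()
support-⊆ (just _ ∷ R) (suc i) x {zero} p = refl
support-⊆ (nothing ∷ R) (suc i) x {suc j} p = support-⊆ R i x p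
support-⊆ (just _ ∷ R) (suc i) x {suc j} p = support-⊆ R i x p

setReg : ∀ {X} → Mach X → ℕ → X → Mach X
setReg (mk R P T v) i a = mk (setℕ R i (just a)) P T (monoP _ _ (support-⊆ R i a) v)

-- renaming addresses (used to see 𝓜 inside the extended machines)
mapRegs : ∀ {X Y : Set} {r} → (X → Y) → Vec (Maybe X) r → Vec (Maybe Y) r
mapRegs f [] = []
mapRegs f (nothing ∷ R) = nothing ∷ mapRegs f R
mapRegs f (just x ∷ R) = just (f x) ∷ mapRegs f R

support-map : ∀ {X Y : Set} {r} (f : X → Y) (R : Vec (Maybe X) r) → support (mapRegs f R) ≡ support R
support-map f [] = refl
support-map f (nothing ∷ R) = cong (false ∷_) (support-map f R)
support-map f (just x ∷ R) = cong (true ∷_) (support-map f R)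

mapMach : ∀ {X Y : Set} → (X → Y) → Mach X → Mach Y
mapMach f (mk R P T v) = mk (mapRegs f R) P (Data.List.map f T) (subst (_⊨P P) (sym (support-map f R)) v)

-- One head-reduction step, generic in the address operations:
--   app  : the application a · b on addresses
--   jump : the machine reached by  Call i  with tape T, i.e. ♯⁻¹(R_i) @ T
-- (head reduction is deterministic; "nothing" = no step)
stepG : ∀ {X Tgt : Set} → (X → X → X) → (X → List X → Tgt) → (Mach X → Tgt) → Mach X → Maybe Tgt
stepG ap jump emb (mk R (load i P) [] v) = nothing
stepG ap jump emb (mk R (load i P) (x ∷ T) (load v)) =
  just (emb (mk (setℕ R i (just x)) P T (subst (_⊨P P) (sym (support-set R i x)) v)))
stepG ap jump emb (mk R (apps (app i j k A)) T (apps (app _ _ v))) with lookupℕ R i | lookupℕ R j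
... | just (just x) | just (just y) =
  just (emb (mk (setℕ R k (just (ap x y))) (apps A) T
                (subst (_⊨P apps A) (sym (support-set R k (ap x y))) (apps v))))
... | _ | _ = nothing
stepG ap jump emb (mk R (apps (end (call i))) T v) with lookupℕ R i
... | just (just x) = just (jump x T)
... | _ = nothing
stepG ap jump emb (mk R (apps (end ε)) T v) = nothing

data Stuck {X : Set} : Mach X → Set where
  stuck : ∀ {r} {R : Vec (Maybe X) r} {i P v} → Stuck (mk R (load i P) [] v)

-- Extended machines over X = 𝔸 ⊎ 𝔹 : ξ@T or an ordinary machine

data Ext (X : Set) : Set where
  hole : List X → Ext X
  mach : Mach X → Ext X

_⊕ₑ_ : ∀ {X} → Ext X → List X → Ext X
hole T ⊕ₑ T' = hole (T ++ T')
mach M ⊕ₑ T' = mach (M ⊕T T')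

data MaybeRel {X : Set} (R : X → X → Set) : Maybe X → Maybe X → Set where
  nothing : MaybeRel R nothing nothing
  just    : ∀ {a b} → R a b → MaybeRel R (just a) (just b)

data VecRel {X : Set} (R : X → X → Set) : ∀ {m n} → Vec X m → Vec X n → Set where
  []  : VecRel R [] []
  _∷_ : ∀ {m n x y} {xs : Vec X m} {ys : Vec X n} → R x y → VecRel R xs ys → VecRel R (x ∷ xs) (y ∷ ys)

data ListRel {X : Set} (R : X → X → Set) : List X → List X → Set where
  []  : ListRel R [] []
  _∷_ : ∀ {x y xs ys} → R x y → ListRel R xs ys → ListRel R (x ∷ xs) (y ∷ ys)

MachRel : ∀ {X : Set} → (X → X → Set) → Mach X → Mach X → Set
MachRel R M N = VecRel (MaybeRel R) (regs M) (regs N) × prog M ≡ prog N × ListRel R (tape M) (tape N)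

-- Countable ordinals as Brouwer trees

data Ord : Set where
  zero : Ord
  suc  : Ord → Ord
  lim  : (ℕ → Ord) → Ord

data _≤ₒ_ : Ord → Ord → Set
data _<ₒ_ : Ord → Ord → Set

data _≤ₒ_ where
  z≤ : ∀ {y} → zero ≤ₒ y
  s≤ : ∀ {x y} → x <ₒ y → suc x ≤ₒ y
  l≤ : ∀ {f y} → (∀ n → f n ≤ₒ y) → lim f ≤ₒ y

data _<ₒ_ where
  <s : ∀ {x y} → x ≤ₒ y → x <ₒ suc y
  <l : ∀ {x f} n → x <ₒ f n → x <ₒ lim f

record Setting : Set₁ where
  field
    𝔸 𝔹 : Set
    𝔸-countable : 𝔸 ↔ ℕ
    𝔹-countable : 𝔹 ↔ ℕ
    ♯  : Mach 𝔸 ↔ 𝔸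
    ♯ₑ : Ext (𝔸 ⊎ 𝔹) ↔ (𝔸 ⊎ 𝔹)
    ♯ₑ-extends : ∀ (M : Mach 𝔸) → Inverse.to ♯ₑ (mach (mapMach inj₁ M)) ≡ inj₁ (Inverse.to ♯ M)

module Theory (S : Setting) where
  open Setting S public

  𝓜 : Set
  𝓜 = Mach 𝔸

  𝕏 : Set
  𝕏 = 𝔸 ⊎ 𝔹

  ExtM : Set
  ExtM = Ext 𝕏

  ♯⁻¹ : 𝔸 → 𝓜
  ♯⁻¹ = Inverse.from ♯

  ♯ₑ⁻¹ : 𝕏 → ExtM
  ♯ₑ⁻¹ = Inverse.from ♯ₑ

  _·_ : 𝔸 → 𝔸 → 𝔸
  a · b = Inverse.to ♯ (♯⁻¹ a ⊕T (b ∷ []))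

  _·ₑ_ : 𝕏 → 𝕏 → 𝕏
  a ·ₑ b = Inverse.to ♯ₑ (♯ₑ⁻¹ a ⊕ₑ (b ∷ []))

  _→h_ : 𝓜 → 𝓜 → Set
  M →h N = stepG _·_ (λ a T → ♯⁻¹ a ⊕T T) (λ K → K) M ≡ just N

  _↠h_ : 𝓜 → 𝓜 → Set
  _↠h_ = Star _→h_

  ↠stuck : 𝓜 → Set
  ↠stuck M = ∃ λ N → M ↠h N × Stuck N

  embed : 𝓜 → ExtM
  embed M = mach (mapMach inj₁ M)

  stepₑ : 𝓜 → ExtM → Maybe ExtM
  stepₑ M (hole T) = just (mach (mapMach inj₁ M ⊕T T))
  stepₑ M (mach K) = stepG _·ₑ_ (λ a T → ♯ₑ⁻¹ a ⊕ₑ T) mach K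

  _⟶[_]_ : ExtM → 𝓜 → ExtM → Set
  C ⟶[ M ] C' = stepₑ M C ≡ just C'

  data _≡𝔸_ : 𝓜 → 𝓜 → Set where
    base  : ∀ {M Z N} → M ↠h Z → MachRel (λ a b → ♯⁻¹ a ≡𝔸 ♯⁻¹ b) Z N → M ≡𝔸 N
    rfl   : ∀ {M} → M ≡𝔸 M
    symm  : ∀ {M N} → M ≡𝔸 N → N ≡𝔸 M
    trans : ∀ {M N L} → M ≡𝔸 N → N ≡𝔸 L → M ≡𝔸 L

  -- the three ordinal-indexed relations ≡_α (eqv), ∼_α (sim), ≈_α (apx)
  data Kind : Set where
    eqv sim apx : Kind

  data Cong : Kind → Set where
    sim : Cong sim
    eqv : Cong eqv

  data Rel : Kind → Ord → 𝓜 → 𝓜 → Set where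
    rfl      : ∀ {k α M} → Rel k α M M
    symm     : ∀ {k α M N} → Rel k α M N → Rel k α N M
    𝔸⇒apx    : ∀ {M N} → M ≡𝔸 N → Rel apx zero M N
    apx⇒sim  : ∀ {α M N} → Rel apx α M N → Rel sim α M N
    sim⇒eqv  : ∀ {α M N} → Rel sim α M N → Rel eqv α M N
    stuckExt : ∀ {α M N} → ↠stuck M → ↠stuck N →
               (∀ (a : 𝔸) → Σ Ord λ γ → γ <ₒ α × Rel eqv γ (M ⊕T (a ∷ [])) (N ⊕T (a ∷ []))) →
               Rel apx α M N
    congReg  : ∀ {k α a b} → Cong k → Rel k α (♯⁻¹ a) (♯⁻¹ b) →
               ∀ (M : 𝓜) i → Rel k α (setReg M i a) (setReg M i b)
    congArg  : ∀ {k α a b} → Cong k → Rel k α (♯⁻¹ a) (♯⁻¹ b) →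
               ∀ (M : 𝓜) → Rel k α (M ⊕T (a ∷ [])) (M ⊕T (b ∷ []))
    congTape : ∀ {k α M N} → Cong k → Rel k α M N → ∀ T → Rel k α (M ⊕T T) (N ⊕T T)
    mono     : ∀ {k γ α M N} → γ ≤ₒ α → Rel k γ M N → Rel k α M N
    trans    : ∀ {α M N L} → Rel eqv α M N → Rel eqv α N L → Rel eqv α M L

  _≡[_]_ : 𝓜 → Ord → 𝓜 → Set
  M ≡[ α ] N = Rel eqv α M N

  _∼[_]_ : 𝓜 → Ord → 𝓜 → Set
  M ∼[ α ] N = Rel sim α M N

  _≈[_]_ : 𝓜 → Ord → 𝓜 → Set
  M ≈[ α ] N = Rel apx α M N

  -- occ_ξ X = n  (addresses of 𝔸 dereference to ordinary machines: 0 occurrences)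
  data OccX : 𝕏 → ℕ → Set
  data OccE : ExtM → ℕ → Set
  data OccT : List 𝕏 → ℕ → Set
  data OccR : ∀ {r} → Vec (Maybe 𝕏) r → ℕ → Set

  data OccX where
    inA : ∀ {a} → OccX (inj₁ a) 0
    inB : ∀ {b n} → OccE (♯ₑ⁻¹ (inj₂ b)) n → OccX (inj₂ b) n

  data OccE where
    hole : ∀ {T n} → OccT T n → OccE (hole T) (suc n)
    mach : ∀ {K m n} → OccR (regs K) m → OccT (tape K) n → OccE (mach K) (m + n)

  data OccT where
    []  : OccT [] 0
    _∷_ : ∀ {x T m n} → OccX x m → OccT T n → OccT (x ∷ T) (m + n)

  data OccR where
    []   : OccR [] 0
    none : ∀ {r} {R : Vec (Maybe 𝕏) r} {n} → OccR R n → OccR (nothing ∷ R) n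
    some : ∀ {r} {R : Vec (Maybe 𝕏) r} {x m n} → OccX x m → OccR R n → OccR (just x ∷ R) (m + n)

  IsContext : ExtM → Set
  IsContext C = ∃ λ n → OccE C n

  module _ (M : 𝓜) where
    data PlugX : 𝕏 → 𝔸 → Set
    data PlugE : ExtM → 𝓜 → Set
    data PlugT : List 𝕏 → List 𝔸 → Set
    data PlugR : ∀ {r} → Vec (Maybe 𝕏) r → Vec (Maybe 𝔸) r → Set

    data PlugX where
      inA : ∀ {a} → PlugX (inj₁ a) a
      inB : ∀ {b K} → PlugE (♯ₑ⁻¹ (inj₂ b)) K → PlugX (inj₂ b) (Inverse.to ♯ K)

    data PlugE where
      hole : ∀ {T T'} → PlugT T T' → PlugE (hole T) (M ⊕T T')
      mach : ∀ {r} {R : Vec (Maybe 𝕏) r} {R' P T T' v v'} → PlugR R R' → PlugT T T' →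
             PlugE (mach (mk R P T v)) (mk R' P T' v')

    data PlugT where
      []  : PlugT [] []
      _∷_ : ∀ {x a T T'} → PlugX x a → PlugT T T' → PlugT (x ∷ T) (a ∷ T')

    data PlugR where
      []   : PlugR [] []
      none : ∀ {r} {R : Vec (Maybe 𝕏) r} {R'} → PlugR R R' → PlugR (nothing ∷ R) (nothing ∷ R')
      some : ∀ {r} {R : Vec (Maybe 𝕏) r} {R' x a} → PlugX x a → PlugR R R' → PlugR (just x ∷ R) (just a ∷ R')

  Plug : 𝓜 → ExtM → 𝓜 → Set
  Plug M C K = PlugE M C K

-- If C is an ordinary machine, its step never touches the hole, and plugging N
-- commutes with it: C⟨N⟩ head-reduces in one step to C'⟨N⟩, so they are ≡₀-related.
-- If C = ξ@T then C' = M@T, and we compare N@T⟨N⟩ with M@T⟨N⟩. Inverting M ≈_α N,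
-- either M ≡_𝔸 N, which survives appending a tape, or both reduce to stuck machines
-- and agree up to some γ < α after appending any one address; in that case T is
-- nonempty, since C'⟨M⟩ = M@T⟨M⟩ does not reduce to a stuck machine, and appending
-- the rest of the tape preserves ≡_γ.
module Submission where

open import Defs
open import Data.Product using (Σ; _×_; _,_; ∃)
open import Relation.Nullary using (¬_)
open import Data.Nat using (zero; suc)
open import Data.Bool using (Bool; true; false)
open import Data.Maybe using (Maybe; just; nothing)
open import Data.Maybe.Relation.Binary.Pointwise using (Pointwise; just; nothing)
open import Data.List using (List; []; _∷_; _++_; map)
open import Data.List.Properties using (++-assoc; ++-identityʳ)
open import Data.Vec using (Vec; []; _∷_)
open import Data.Sum as Sum using (_⊎_; inj₁; inj₂)
open import Data.Empty using (⊥-elim)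
open import Function using (_∘_)
open import Function.Bundles using (Inverse)
open import Axiom.UniquenessOfIdentityProofs.WithK using (uip)
open import Relation.Binary.PropositionalEquality
open import Relation.Binary.Construct.Closure.ReflexiveTransitive using (ε; _◅_)

mutual
  ≤ₒ-trans : ∀ {x y z} → x ≤ₒ y → y ≤ₒ z → x ≤ₒ z
  ≤ₒ-trans z≤ y≤z = z≤
  ≤ₒ-trans (s≤ x<y) y≤z = s≤ (<ₒ-≤ₒ-trans x<y y≤z)
  ≤ₒ-trans (l≤ f≤y) y≤z = l≤ (λ n → ≤ₒ-trans (f≤y n) y≤z)

  <ₒ-≤ₒ-trans : ∀ {x y z} → x <ₒ y → y ≤ₒ z → x <ₒ z
  <ₒ-≤ₒ-trans (<s x≤y) (s≤ y<z) = ≤ₒ-<ₒ-trans x≤y y<z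
  <ₒ-≤ₒ-trans (<l n x<fn) (l≤ f≤z) = <ₒ-≤ₒ-trans x<fn (f≤z n)

  ≤ₒ-<ₒ-trans : ∀ {x y z} → x ≤ₒ y → y <ₒ z → x <ₒ z
  ≤ₒ-<ₒ-trans x≤y (<s y≤z) = <s (≤ₒ-trans x≤y y≤z)
  ≤ₒ-<ₒ-trans x≤y (<l n y<fn) = <l n (≤ₒ-<ₒ-trans x≤y y<fn)

⊨C-irrelevant : ∀ {r} {I : Vec Bool r} {C} (p q : I ⊨C C) → p ≡ q
⊨C-irrelevant ε ε = refl
⊨C-irrelevant (call p) (call q) = cong call (uip p q)

⊨A-irrelevant : ∀ {r} {I : Vec Bool r} {A} (p q : I ⊨A A) → p ≡ q
⊨A-irrelevant (app p₁ p₂ p) (app q₁ q₂ q)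
  rewrite uip p₁ q₁ | uip p₂ q₂ = cong (app q₁ q₂) (⊨A-irrelevant p q)
⊨A-irrelevant (end p) (end q) = cong end (⊨C-irrelevant p q)

⊨P-irrelevant : ∀ {r} {I : Vec Bool r} {P} (p q : I ⊨P P) → p ≡ q
⊨P-irrelevant (load p) (load q) = cong load (⊨P-irrelevant p q)
⊨P-irrelevant (apps p) (apps q) = cong apps (⊨A-irrelevant p q)

mk-cong : ∀ {X : Set} {r} {R₁ R₂ : Vec (Maybe X) r} {P T₁ T₂ v₁ v₂} →
          R₁ ≡ R₂ → T₁ ≡ T₂ → mk R₁ P T₁ v₁ ≡ mk R₂ P T₂ v₂
mk-cong {v₁ = v₁} {v₂} refl refl = cong (mk _ _ _) (⊨P-irrelevant v₁ v₂)

⊕T-assoc : ∀ {X : Set} (K : Mach X) T₁ T₂ → (K ⊕T T₁) ⊕T T₂ ≡ K ⊕T (T₁ ++ T₂)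
⊕T-assoc (mk R P T v) T₁ T₂ = mk-cong refl (++-assoc T T₁ T₂)

⊕T-identityʳ : ∀ {X : Set} (K : Mach X) → K ⊕T [] ≡ K
⊕T-identityʳ (mk R P T v) = mk-cong refl (++-identityʳ T)

Pointwise-just : ∀ {A B : Set} {R : A → B → Set} {m n x} →
                 Pointwise R m n → m ≡ just x → ∃ λ y → n ≡ just y × R x y
Pointwise-just (just r) refl = _ , refl , r

module _ (S : Setting) where
  open Theory S hiding (trans)
  open Inverse using (to; inverseʳ; strictlyInverseˡ; strictlyInverseʳ)

  ♯ₑ⁻¹-inj₁ : ∀ a → ♯ₑ⁻¹ (inj₁ a) ≡ embed (♯⁻¹ a)
  ♯ₑ⁻¹-inj₁ a = begin
    ♯ₑ⁻¹ (inj₁ a)                  ≡⟨ cong (♯ₑ⁻¹ ∘ inj₁) (strictlyInverseˡ ♯ a) ⟨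
    ♯ₑ⁻¹ (inj₁ (to ♯ (♯⁻¹ a)))     ≡⟨ cong ♯ₑ⁻¹ (♯ₑ-extends (♯⁻¹ a)) ⟨
    ♯ₑ⁻¹ (to ♯ₑ (embed (♯⁻¹ a)))   ≡⟨ strictlyInverseʳ ♯ₑ _ ⟩
    embed (♯⁻¹ a)                  ∎
    where open ≡-Reasoning

  head-step : 𝓜 → Maybe 𝓜
  head-step = stepG _·_ (λ a T → ♯⁻¹ a ⊕T T) (λ K → K)

  module _ (L : 𝓜) where

    mutual
      plugX-functional : ∀ {x a b} → PlugX L x a → PlugX L x b → a ≡ b
      plugX-functional inA inA = refl
      plugX-functional (inB p) (inB q) = cong (to ♯) (plugE-functional p q)

      plugE-functional : ∀ {C K₁ K₂} → PlugE L C K₁ → PlugE L C K₂ → K₁ ≡ K₂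
      plugE-functional (hole p) (hole q) = cong (L ⊕T_) (plugT-functional p q)
      plugE-functional (mach r t) (mach r' t') = mk-cong (plugR-functional r r') (plugT-functional t t')

      plugT-functional : ∀ {T T₁ T₂} → PlugT L T T₁ → PlugT L T T₂ → T₁ ≡ T₂
      plugT-functional [] [] = refl
      plugT-functional (x ∷ p) (y ∷ q) = cong₂ _∷_ (plugX-functional x y) (plugT-functional p q)

      plugR-functional : ∀ {r} {R : Vec (Maybe 𝕏) r} {R₁ R₂} → PlugR L R R₁ → PlugR L R R₂ → R₁ ≡ R₂
      plugR-functional [] [] = refl
      plugR-functional (none p) (none q) = cong (nothing ∷_) (plugR-functional p q)
      plugR-functional (some x p) (some y q) =
        cong₂ (λ a R → just a ∷ R) (plugX-functional x y) (plugR-functional p q)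

    plugR-support : ∀ {r} {R : Vec (Maybe 𝕏) r} {R'} → PlugR L R R' → support R' ≡ support R
    plugR-support [] = refl
    plugR-support (none p) = cong (false ∷_) (plugR-support p)
    plugR-support (some x p) = cong (true ∷_) (plugR-support p)

    mutual
      plugX-exists : ∀ {x n} → OccX x n → Σ 𝔸 (PlugX L x)
      plugX-exists inA = _ , inA
      plugX-exists (inB o) = let (_ , p) = plugE-exists o in _ , inB p

      plugE-exists : ∀ {C n} → OccE C n → Σ 𝓜 (PlugE L C)
      plugE-exists (hole o) = let (_ , p) = plugT-exists o in _ , hole p
      plugE-exists (mach {K = mk R P T v} oR oT) =
        let (R' , pR) = plugR-exists oR ; (T' , pT) = plugT-exists oT in
        mk R' P T' (subst (_⊨P P) (sym (plugR-support pR)) v) , mach pR pT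

      plugT-exists : ∀ {T n} → OccT T n → Σ (List 𝔸) (PlugT L T)
      plugT-exists [] = _ , []
      plugT-exists (o ∷ os) =
        let (_ , p) = plugX-exists o ; (_ , ps) = plugT-exists os in _ , p ∷ ps

      plugR-exists : ∀ {r} {R : Vec (Maybe 𝕏) r} {n} → OccR R n → Σ (Vec (Maybe 𝔸) r) (PlugR L R)
      plugR-exists [] = _ , []
      plugR-exists (none os) = let (_ , ps) = plugR-exists os in _ , none ps
      plugR-exists (some o os) =
        let (_ , p) = plugX-exists o ; (_ , ps) = plugR-exists os in _ , some p ps

    plugT-++ : ∀ {T₁ T₁' T₂ T₂'} → PlugT L T₁ T₁' → PlugT L T₂ T₂' → PlugT L (T₁ ++ T₂) (T₁' ++ T₂')
    plugT-++ [] q = q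
    plugT-++ (p ∷ ps) q = p ∷ plugT-++ ps q

    plugE-⊕ : ∀ {C K T T'} → PlugE L C K → PlugT L T T' → PlugE L (C ⊕ₑ T) (K ⊕T T')
    plugE-⊕ (hole {T' = T₁'} p) q = subst (PlugE L _) (sym (⊕T-assoc L T₁' _)) (hole (plugT-++ p q))
    plugE-⊕ (mach r t) q = mach r (plugT-++ t q)

    plug-embed : ∀ K → PlugE L (embed K) K
    plug-embed (mk R P T v) = mach (plugR-inj₁ R) (plugT-inj₁ T)
      where
      plugT-inj₁ : ∀ T → PlugT L (map inj₁ T) T
      plugT-inj₁ [] = []
      plugT-inj₁ (a ∷ T) = inA ∷ plugT-inj₁ T

      plugR-inj₁ : ∀ {r} (R : Vec (Maybe 𝔸) r) → PlugR L (mapRegs inj₁ R) R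
      plugR-inj₁ [] = []
      plugR-inj₁ (nothing ∷ R) = none (plugR-inj₁ R)
      plugR-inj₁ (just a ∷ R) = some inA (plugR-inj₁ R)

    plug-deref : ∀ {x a} → PlugX L x a → PlugE L (♯ₑ⁻¹ x) (♯⁻¹ a)
    plug-deref (inA {a}) = subst (λ C → PlugE L C (♯⁻¹ a)) (sym (♯ₑ⁻¹-inj₁ a)) (plug-embed (♯⁻¹ a))
    plug-deref (inB {K = K} p) = subst (PlugE L _) (sym (strictlyInverseʳ ♯ K)) p

    -- An 𝔸-address codes an embedded ordinary machine, whose only plugging is itself.
    plug-code : ∀ {C K} → PlugE L C K → PlugX L (to ♯ₑ C) (to ♯ K)
    plug-code {C} {K} p with to ♯ₑ C in code
    ... | inj₂ b = inB (subst (λ C' → PlugE L C' K) (sym (inverseʳ ♯ₑ (sym code))) p)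
    ... | inj₁ a = subst (PlugX L (inj₁ a)) (sym to♯K≡a) inA
      where
      C≡embed : C ≡ embed (♯⁻¹ a)
      C≡embed = trans (sym (inverseʳ ♯ₑ (sym code))) (♯ₑ⁻¹-inj₁ a)

      to♯K≡a : to ♯ K ≡ a
      to♯K≡a = begin
        to ♯ K         ≡⟨ cong (to ♯) (plugE-functional (subst (λ C' → PlugE L C' K) C≡embed p)
                                                        (plug-embed (♯⁻¹ a))) ⟩
        to ♯ (♯⁻¹ a)   ≡⟨ strictlyInverseˡ ♯ a ⟩
        a              ∎
        where open ≡-Reasoning

    plug-· : ∀ {x y a b} → PlugX L x a → PlugX L y b → PlugX L (x ·ₑ y) (a · b)
    plug-· pa pb = plug-code (plugE-⊕ (plug-deref pa) (pb ∷ []))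

    plugR-set : ∀ {r} {R : Vec (Maybe 𝕏) r} {R' x a} → PlugR L R R' → PlugX L x a → ∀ k →
                PlugR L (setℕ R k (just x)) (setℕ R' k (just a))
    plugR-set [] q k = []
    plugR-set (none p) q zero = some q p
    plugR-set (some _ p) q zero = some q p
    plugR-set (none p) q (suc k) = none (plugR-set p q k)
    plugR-set (some y p) q (suc k) = some y (plugR-set p q k)

    plugR-lookup : ∀ {r} {R : Vec (Maybe 𝕏) r} {R'} → PlugR L R R' → ∀ i →
                   Pointwise (Pointwise (PlugX L)) (lookupℕ R i) (lookupℕ R' i)
    plugR-lookup [] i = nothing
    plugR-lookup (none p) zero = just nothing
    plugR-lookup (some x p) zero = just (just x)
    plugR-lookup (none p) (suc i) = plugR-lookup p i
    plugR-lookup (some x p) (suc i) = plugR-lookup p i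

    -- The underlined machine M only matters for a hole, so it is arbitrary here; the
    -- validity proofs are matched so that stepG reduces on both sides.
    plug-step : ∀ M {K KL} → PlugE L (mach K) KL → Pointwise (PlugE L) (stepₑ M (mach K)) (head-step KL)
    plug-step M {mk _ (load _ _) [] _} (mach _ []) = nothing
    plug-step M {mk _ (load i _) (_ ∷ _) (load _)} (mach {v' = load _} r (px ∷ t)) =
      just (mach (plugR-set r px i) t)
    plug-step M {mk R (apps (app i j k A)) _ (apps (app _ _ _))} (mach {R' = R'} {v' = apps (app _ _ _)} r t)
      with lookupℕ R i | lookupℕ R' i | plugR-lookup r i | lookupℕ R j | lookupℕ R' j | plugR-lookup r j
    ... | just (just _) | just (just _) | just (just pa) | just (just _) | just (just _) | just (just pb) =
      just (mach (plugR-set r (plug-· pa pb) k) t)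
    ... | just (just _) | just (just _) | just (just _) | just nothing | just nothing | just nothing = nothing
    ... | just (just _) | just (just _) | just (just _) | nothing | nothing | nothing = nothing
    ... | just nothing | just nothing | just nothing | _ | _ | _ = nothing
    ... | nothing | nothing | nothing | _ | _ | _ = nothing
    plug-step M {mk R (apps (end (call i))) _ _} (mach {R' = R'} r t)
      with lookupℕ R i | lookupℕ R' i | plugR-lookup r i
    ... | just (just _) | just (just _) | just (just pa) = just (plugE-⊕ (plug-deref pa) t)
    ... | just nothing | just nothing | just nothing = nothing
    ... | nothing | nothing | nothing = nothing
    plug-step M {mk _ (apps (end ε)) _ _} (mach _ _) = nothing

    plug-simulates-step : ∀ M {K C' KL} → mach K ⟶[ M ] C' → PlugE L (mach K) KL →
                          Σ 𝓜 λ Z → KL →h Z × PlugE L C' Z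
    plug-simulates-step M K⟶C' p = Pointwise-just (plug-step M p) K⟶C'

  StuckExtensional : Ord → 𝓜 → 𝓜 → Set
  StuckExtensional α M N = ↠stuck M × ↠stuck N ×
    (∀ a → Σ Ord λ γ → γ <ₒ α × (M ⊕T (a ∷ [])) ≡[ γ ] (N ⊕T (a ∷ [])))

  StuckExtensional-sym : ∀ {α M N} → StuckExtensional α M N → StuckExtensional α N M
  StuckExtensional-sym (M↠stuck , N↠stuck , ext) =
    N↠stuck , M↠stuck , λ a → let (γ , γ<α , r) = ext a in γ , γ<α , symm r

  StuckExtensional-mono : ∀ {β α M N} → β ≤ₒ α → StuckExtensional β M N → StuckExtensional α M N
  StuckExtensional-mono β≤α (M↠stuck , N↠stuck , ext) =
    M↠stuck , N↠stuck , λ a → let (γ , γ<β , r) = ext a in γ , <ₒ-≤ₒ-trans γ<β β≤α , r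

  ≈-inversion : ∀ {α M N} → M ≈[ α ] N → M ≡𝔸 N ⊎ StuckExtensional α M N
  ≈-inversion rfl = inj₁ rfl
  ≈-inversion (symm r) = Sum.map symm StuckExtensional-sym (≈-inversion r)
  ≈-inversion (𝔸⇒apx e) = inj₁ e
  ≈-inversion (stuckExt M↠stuck N↠stuck ext) = inj₂ (M↠stuck , N↠stuck , ext)
  ≈-inversion (congReg () _ _ _)
  ≈-inversion (congArg () _ _)
  ≈-inversion (congTape () _ _)
  ≈-inversion (mono β≤α r) = Sum.map₂ (StuckExtensional-mono β≤α) (≈-inversion r)

  ≡𝔸⇒≡₀ : ∀ {M N} → M ≡𝔸 N → M ≡[ zero ] N
  ≡𝔸⇒≡₀ = sim⇒eqv ∘ apx⇒sim ∘ 𝔸⇒apx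

  →h⇒≡𝔸 : ∀ {M N} → M →h N → M ≡𝔸 N
  →h⇒≡𝔸 {N = mk R P T _} M→N = base (M→N ◅ ε) (regs-refl R , refl , tape-refl T)
    where
    regs-refl : ∀ {r} (R : Vec (Maybe 𝔸) r) → VecRel (MaybeRel (λ a b → ♯⁻¹ a ≡𝔸 ♯⁻¹ b)) R R
    regs-refl [] = []
    regs-refl (nothing ∷ R) = nothing ∷ regs-refl R
    regs-refl (just _ ∷ R) = just rfl ∷ regs-refl R

    tape-refl : ∀ T → ListRel (λ a b → ♯⁻¹ a ≡𝔸 ♯⁻¹ b) T T
    tape-refl [] = []
    tape-refl (_ ∷ T) = rfl ∷ tape-refl T

  ≈∧¬↠stuck⇒≡𝔸 : ∀ {α M N} → M ≈[ α ] N → ¬ ↠stuck M → M ≡𝔸 N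
  ≈∧¬↠stuck⇒≡𝔸 M≈N M-not-stuck with ≈-inversion M≈N
  ... | inj₁ M≡𝔸N = M≡𝔸N
  ... | inj₂ (M↠stuck , _) = ⊥-elim (M-not-stuck M↠stuck)

  ≈⇒≡-⊕T-∷ : ∀ {α M N} → zero <ₒ α → M ≈[ α ] N → ∀ a T →
             Σ Ord λ γ → γ <ₒ α × (M ⊕T (a ∷ T)) ≡[ γ ] (N ⊕T (a ∷ T))
  ≈⇒≡-⊕T-∷ {M = M} {N} 0<α M≈N a T with ≈-inversion M≈N
  ... | inj₁ M≡𝔸N = zero , 0<α , congTape eqv (≡𝔸⇒≡₀ M≡𝔸N) (a ∷ T)
  ... | inj₂ (_ , _ , ext) =
    let (γ , γ<α , Ma≡Na) = ext a in
    γ , γ<α , subst₂ _≡[ γ ]_ (⊕T-assoc M _ T) (⊕T-assoc N _ T) (congTape eqv Ma≡Na T)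

  hole-step-≡ : ∀ {α M N T TN} → zero <ₒ α → M ≈[ α ] N → PlugT N T TN →
                (∀ K → Plug M (embed M ⊕ₑ T) K → ¬ ↠stuck K) →
                Σ Ord λ γ → γ <ₒ α × (N ⊕T TN) ≡[ γ ] (M ⊕T TN)
  hole-step-≡ {M = M} 0<α M≈N [] C'⟨M⟩-not-stuck =
    zero , 0<α , symm (congTape eqv (≡𝔸⇒≡₀ (≈∧¬↠stuck⇒≡𝔸 M≈N M-not-stuck)) [])
    where
    M-not-stuck : ¬ ↠stuck M
    M-not-stuck = C'⟨M⟩-not-stuck (M ⊕T []) (plugE-⊕ M (plug-embed M M) [])
                ∘ subst ↠stuck (sym (⊕T-identityʳ M))
  hole-step-≡ 0<α M≈N (_ ∷ _) _ =
    let (γ , γ<α , M⊕T≡N⊕T) = ≈⇒≡-⊕T-∷ 0<α M≈N _ _ in γ , γ<α , symm M⊕T≡N⊕T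

open Theory using (hole)

lemma5p9 : (S : Setting) → let open Theory S in
    (α : Ord) (C C' : ExtM) (M N : 𝓜) →
    zero <ₒ α → IsContext C → M ≈[ α ] N →
    C ⟶[ M ] C' → IsContext C' →
    (∀ K → Plug M C' K → ¬ ↠stuck K) →
    Σ Ord λ γ → γ <ₒ α × Σ 𝓜 λ CN → Σ 𝓜 λ C'N →
      Plug N C CN × Plug N C' C'N × CN ≡[ γ ] C'N
lemma5p9 S α (mach K) C' M N 0<α (_ , C-finite) _ C⟶C' _ _ =
  let (CN , C⟨N⟩) = plugE-exists S N C-finite
      (C'N , CN→C'N , C'⟨N⟩) = plug-simulates-step S N M C⟶C' C⟨N⟩
  in zero , 0<α , CN , C'N , C⟨N⟩ , C'⟨N⟩ , ≡𝔸⇒≡₀ S (→h⇒≡𝔸 S CN→C'N)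
lemma5p9 S α (hole T) _ M N 0<α (_ , hole T-finite) M≈N refl _ C'⟨M⟩-not-stuck =
  let (TN , T⟨N⟩) = plugT-exists S N T-finite
      (γ , γ<α , N⊕TN≡M⊕TN) = hole-step-≡ S 0<α M≈N T⟨N⟩ C'⟨M⟩-not-stuck
  in γ , γ<α , _ , _ , hole T⟨N⟩ , plugE-⊕ S N (plug-embed S N M) T⟨N⟩ , N⊕TN≡M⊕TN
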